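{- Let $G,G'$ be colored graphs with disjoint vertex sets, and consider the Ehrenfeucht game on $G$ and $G'$. Let $\bar x=(x_1,\dots,x_s)$, $\bar y=(y_1,\dots,y_s)$ be the configuration after the $s$-th round. For $I\subset[s]$ let $X_I=\{x_h:h\in I\}$ and $Y_I=\{y_h:h\in I\}$. Assume there are $i,j\in[s]$ and $I\subset[s]$ such that $x_i$ and $x_j$ lie in the same $X_I$-flap $F$ of $G$, while $y_i$ and $y_j$ lie in different $Y_I$-flaps of $G'$. Then Spoiler has a strategy, in which he places pebbles only on vertices of $G$, that guarantees his win (i.e., the winning condition for Duplicator fails) within at most $\lceil\log|F|\rceil$ further rounds, whatever Duplicator does.
   Context: A colored graph is a finite simple graph together with unary relations $C_1,C_2,\dots$ on its vertices (vertex $v$ has color $i$ if $C_i(v)$ holds; each vertex has finitely many colors). For $X\subseteq V(G)$, an $X$-flap of $G$ is a connected component of the graph $G\setminus X$ obtained by deleting the vertices of $X$. $[s]=\{1,\dots,s\}$; $|F|$ is the number of vertices of $F$; $\log$ is base 2. Ehrenfeucht game on $G,G'$: two players, Spoiler and Duplicator, play rounds; in round $t$ Spoiler chooses one of the graphs and a vertex in it, and Duplicator responds with a vertex in the other graph; $x_t\in V(G)$ and $y_t\in V(G')$ denote the vertices chosen in round $t$ (regardless of who chose them). Repeated choices of a vertex are allowed. Duplicator wins an $r$-round game if after each of the $r$ rounds: $x_a=x_b$ iff $y_a=y_b$ for all $a,b$, and the map $x_a\mapsto y_a$ is a partial isomorphism, i.e., it preserves adjacency, non-adjacency and all colors. Otherwise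 Spoiler wins. -}

module Defs where

open import Data.Nat using (ℕ; _≤_; _+_)
open import Data.Bool using (Bool; true; false)
open import Data.Fin using (Fin; toℕ; splitAt)
open import Data.Fin.Subset using (Subset; _∈_; _∉_)
open import Data.Sum using (_⊎_; inj₁; inj₂)
open import Data.Product using (Σ; ∃; _×_; _,_)
open import Relation.Binary.PropositionalEquality using (_≡_)
open import Relation.Nullary using (¬_)

record ColoredGraph : Set where
  field
    size      : ℕ
    adj       : Fin size → Fin size → Bool
    adj-sym   : ∀ u v → adj u v ≡ adj v u
    adj-irr   : ∀ v → adj v v ≡ false
    color     : Fin size → ℕ → Bool
    finColors : ∀ v → ∃ λ b → ∀ c → b ≤ c → color v c ≡ false
  V : Set
  V = Fin size
open ColoredGraph public

-- Walks in G all of whose vertices satisfy P (i.e. walks in the induced subgraph on P).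
data ConnIn (G : ColoredGraph) (P : V G → Set) : V G → V G → Set where
  here : ∀ {u} → P u → ConnIn G P u u
  step : ∀ {u w v} → P u → adj G u w ≡ true → ConnIn G P w v → ConnIn G P u v

-- F is an X-flap of G: a connected component of G ∖ X
-- (nonempty, disjoint from X, connected in G ∖ X, and closed under
-- adjacency inside G ∖ X, i.e. maximal).
IsFlap : (G : ColoredGraph) → (V G → Set) → Subset (size G) → Set
IsFlap G X F =
  (∃ λ v → v ∈ F)
  × (∀ v → v ∈ F → ¬ X v)
  × (∀ u v → u ∈ F → v ∈ F → ConnIn G (λ w → ¬ X w) u v)
  × (∀ u v → u ∈ F → ¬ X v → adj G u v ≡ true → v ∈ F)

Img : ∀ {s} {A : Set} → (Fin s → A) → Subset s → A → Set
Img {s} x I v = ∃ λ (h : Fin s) → h ∈ I × x h ≡ v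

-- Duplicator's winning condition after r rounds for configuration x, y:
-- equality pattern preserved and x_a ↦ y_a a partial isomorphism
-- (adjacency, non-adjacency and all colors preserved).
DupOK : (G G' : ColoredGraph) (r : ℕ) → (Fin r → V G) → (Fin r → V G') → Set
DupOK G G' r x y = ∀ (a b : Fin r) →
  ((x a ≡ x b → y a ≡ y b) × (y a ≡ y b → x a ≡ x b))
  × adj G (x a) (x b) ≡ adj G' (y a) (y b)
  × (∀ c → color G (x a) c ≡ color G' (y a) c)

-- Extend an s-round configuration by further moves (indexed by ℕ, round s+1+t ↦ f t).
extend : ∀ {A : Set} s {t} → (Fin s → A) → (ℕ → A) → Fin (s + t) → A
extend s x f i with splitAt s i
... | inj₁ a = x a
... | inj₂ b = f (toℕ b)

SpoilerStrategyInG : (G G' : ColoredGraph) → Set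
SpoilerStrategyInG G G' = (t : ℕ) → (Fin t → V G') → V G

spoilerMoves : ∀ {G G'} → SpoilerStrategyInG G G' → (ℕ → V G') → ℕ → V G
spoilerMoves σ ρ t = σ t (λ i → ρ (toℕ i))

{-# OPTIONS --safe #-}
module Submission where

-- Take a simple path x_i = p 0, …, p m = x_j inside the flap F, so m < |F|.
-- Spoiler binary-searches the positions 0 … m, keeping an interval [lo, hi] such
-- that p lo is pebbled with a reply inside the Y_I-flap F₁ of y_i and p hi with
-- a reply outside F₁; each round he pebbles the midpoint and keeps the half whose
-- endpoints still disagree.  After ⌈log₂ |F|⌉ rounds hi ≤ lo + 1, so p lo and p hi
-- are equal or adjacent vertices outside X_I.  A partial isomorphism would map
-- them to equal or adjacent vertices outside Y_I, which lie in the same Y_I-flap.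

open import Defs
open import Data.Nat using (ℕ; _≤_; _+_)
open import Data.Nat.Logarithm using (⌈log₂_⌉)
open import Data.Fin using (Fin)
open import Data.Fin.Subset using (Subset; _∈_; _∉_; ∣_∣)
open import Data.Product using (Σ; ∃; _×_; _,_)
open import Relation.Nullary using (¬_)

open import Data.Bool using (true; false; if_then_else_)
open import Data.Nat using (zero; suc; _<_; _∸_; z≤n; s≤s; ⌊_/2⌋; ⌈_/2⌉; _≤?_)
open import Data.Nat.Properties
open import Data.Nat.Logarithm using (⌈log₂⌉-mono-≤; ⌈log₂⌈n/2⌉⌉≡⌈log₂n⌉∸1)
open import Data.Fin using (zero; suc; toℕ; fromℕ<; _↑ˡ_; _↑ʳ_) renaming (_≟_ to _≟ᶠ_)
open import Data.Fin.Properties using (splitAt-↑ˡ; splitAt-↑ʳ; toℕ-fromℕ<)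
open import Data.Fin.Subset using (_-_)
open import Data.Fin.Subset.Properties using (_∈?_; x∈p∧x≢y⇒x∈p-y; x∈p⇒∣p-x∣<∣p∣)
open import Data.List using (List; []; _∷_; length)
open import Data.List.Membership.Propositional using () renaming (_∈_ to _∈ₗ_)
open import Data.List.Relation.Unary.All as All using (All; []; _∷_)
open import Data.List.Relation.Unary.All.Properties using (¬Any⇒All¬)
open import Data.List.Relation.Unary.Any using (here; there; any?)
open import Data.List.Relation.Unary.Unique.Propositional using (Unique; []; _∷_)
open import Data.Product using (proj₁; proj₂)
open import Data.Sum as Sum using (_⊎_; inj₁; inj₂)
open import Function using (_∘_)
open import Relation.Nullary using (yes; no; does; contradiction)
open import Relation.Unary using (Decidable)
open import Relation.Binary.PropositionalEquality

unique⇒length≤∣p∣ : ∀ {n} {p : Subset n} {xs : List (Fin n)} →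
                    Unique xs → All (_∈ p) xs → length xs ≤ ∣ p ∣
unique⇒length≤∣p∣ [] [] = z≤n
unique⇒length≤∣p∣ {p = p} {x ∷ xs} (x≢xs ∷ uniq) (x∈p ∷ xs⊆p) =
  ≤-trans (s≤s (unique⇒length≤∣p∣ uniq xs⊆p-x)) (x∈p⇒∣p-x∣<∣p∣ x∈p)
  where
  xs⊆p-x : All (_∈ p - x) xs
  xs⊆p-x = All.zipWith (λ (y∈p , x≢y) → x∈p∧x≢y⇒x∈p-y y∈p (x≢y ∘ sym)) (xs⊆p , x≢xs)

⌈log₂n⌉≡0⇒n≤1 : ∀ {n} → ⌈log₂ n ⌉ ≡ 0 → n ≤ 1
⌈log₂n⌉≡0⇒n≤1 {n} log≡0 with n ≤? 1
... | yes n≤1 = n≤1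
... | no  n≰1 = contradiction (subst (1 ≤_) log≡0 (⌈log₂⌉-mono-≤ (≰⇒> n≰1))) λ ()

extend-↑ˡ : ∀ {A : Set} s t (x : Fin s → A) (f : ℕ → A) h → extend s {t} x f (h ↑ˡ t) ≡ x h
extend-↑ˡ s t x f h rewrite splitAt-↑ˡ s h t = refl

extend-↑ʳ : ∀ {A : Set} s t (x : Fin s → A) (f : ℕ → A) b → extend s {t} x f (s ↑ʳ b) ≡ f (toℕ b)
extend-↑ʳ s t x f b rewrite splitAt-↑ʳ s t b = refl

AdjOrEq : (G : ColoredGraph) → V G → V G → Set
AdjOrEq G u v = u ≡ v ⊎ adj G u v ≡ true

AdjClosed : (G : ColoredGraph) → (V G → Set) → Subset (size G) → Set
AdjClosed G P F = ∀ u v → u ∈ F → P v → adj G u v ≡ true → v ∈ F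

AdjClosed-AdjOrEq : ∀ {G P F u v} → AdjClosed G P F → AdjOrEq G u v → u ∈ F → P v → v ∈ F
AdjClosed-AdjOrEq closed (inj₁ refl) u∈F _  = u∈F
AdjClosed-AdjOrEq closed (inj₂ uv)   u∈F pv = closed _ _ u∈F pv uv

module _ {G : ColoredGraph} {P : V G → Set} where

  len : ∀ {u v} → ConnIn G P u v → ℕ
  len (here _)     = 0
  len (step _ _ w) = suc (len w)

  -- Positions past the end all read the last vertex, so consecutive positions
  -- always carry equal or adjacent vertices.
  vertexAt : ∀ {u v} → ConnIn G P u v → ℕ → V G
  vertexAt (here {u} _)     _       = u
  vertexAt (step {u} _ _ _) zero    = u
  vertexAt (step _ _ w)     (suc k) = vertexAt w k

  vertexAt-zero : ∀ {u v} (w : ConnIn G P u v) → vertexAt w 0 ≡ u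
  vertexAt-zero (here _)     = refl
  vertexAt-zero (step _ _ _) = refl

  vertexAt-len : ∀ {u v} (w : ConnIn G P u v) → vertexAt w (len w) ≡ v
  vertexAt-len (here _)     = refl
  vertexAt-len (step _ _ w) = vertexAt-len w

  vertexAt-inside : ∀ {u v} (w : ConnIn G P u v) k → P (vertexAt w k)
  vertexAt-inside (here pu)     _       = pu
  vertexAt-inside (step pu _ _) zero    = pu
  vertexAt-inside (step _ _ w)  (suc k) = vertexAt-inside w k

  vertexAt-suc : ∀ {u v} (w : ConnIn G P u v) k → AdjOrEq G (vertexAt w k) (vertexAt w (suc k))
  vertexAt-suc (here _)      _       = inj₁ refl
  vertexAt-suc (step _ uw w) zero    rewrite vertexAt-zero w = inj₂ uw
  vertexAt-suc (step _ _ w)  (suc k) = vertexAt-suc w k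

  vertexAt-+≤1 : ∀ {u v} (w : ConnIn G P u v) k {d} → d ≤ 1 →
                 AdjOrEq G (vertexAt w k) (vertexAt w (k + d))
  vertexAt-+≤1 w k z≤n       rewrite +-identityʳ k = inj₁ refl
  vertexAt-+≤1 w k (s≤s z≤n) rewrite +-comm k 1    = vertexAt-suc w k

  vertices : ∀ {u v} → ConnIn G P u v → List (V G)
  vertices (here {u} _)     = u ∷ []
  vertices (step {u} _ _ w) = u ∷ vertices w

  length-vertices : ∀ {u v} (w : ConnIn G P u v) → length (vertices w) ≡ suc (len w)
  length-vertices (here _)     = refl
  length-vertices (step _ _ w) = cong suc (length-vertices w)

  vertices-⊆ : ∀ {F u v} → AdjClosed G P F → (w : ConnIn G P u v) → u ∈ F →
               All (_∈ F) (vertices w)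
  vertices-⊆ closed (here _)      u∈F = u∈F ∷ []
  vertices-⊆ closed (step _ uw w) u∈F =
    u∈F ∷ vertices-⊆ closed w (closed _ _ u∈F (subst P (vertexAt-zero w) (vertexAt-inside w 0)) uw)

  Path : V G → V G → Set
  Path u v = Σ (ConnIn G P u v) λ w → Unique (vertices w)

  dropUntil : ∀ {u v z} (w : ConnIn G P u v) → Unique (vertices w) → z ∈ₗ vertices w → Path z v
  dropUntil (here pu)      uniq       (here refl) = here pu , uniq
  dropUntil (step pu uw w) uniq       (here refl) = step pu uw w , uniq
  dropUntil (step _ _ w)   (_ ∷ uniq) (there z∈w) = dropUntil w uniq z∈w

  toPath : ∀ {u v} → ConnIn G P u v → Path u v
  toPath (here pu) = here pu , [] ∷ []
  toPath (step {u} pu uw w) with toPath w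
  ... | w′ , uniq with any? (u ≟ᶠ_) (vertices w′)
  ...   | yes u∈w′ = dropUntil w′ uniq u∈w′
  ...   | no  u∉w′ = step pu uw w′ , ¬Any⇒All¬ (vertices w′) u∉w′ ∷ uniq

  len<∣F∣ : ∀ {F u v} → AdjClosed G P F → ((w , _) : Path u v) → u ∈ F → len w < ∣ F ∣
  len<∣F∣ {F} closed (w , uniq) u∈F =
    subst (_≤ ∣ F ∣) (length-vertices w) (unique⇒length≤∣p∣ uniq (vertices-⊆ closed w u∈F))

module _ {G G' : ColoredGraph} {n} {X : Fin n → V G} {Y : Fin n → V G'} (ok : DupOK G G' n X Y) where

  DupOK-preserves-AdjOrEq : ∀ a b → AdjOrEq G (X a) (X b) → AdjOrEq G' (Y a) (Y b)
  DupOK-preserves-AdjOrEq a b (inj₁ Xa≡Xb) = inj₁ (proj₁ (proj₁ (ok a b)) Xa≡Xb)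
  DupOK-preserves-AdjOrEq a b (inj₂ XaXb)  = inj₂ (trans (sym (proj₁ (proj₂ (ok a b)))) XaXb)

  DupOK-reflects-Img : ∀ {s} {x : Fin s → V G} {y : Fin s → V G'} (e : Fin s → Fin n) →
                       (∀ h → X (e h) ≡ x h) → (∀ h → Y (e h) ≡ y h) →
                       ∀ I b → Img y I (Y b) → Img x I (X b)
  DupOK-reflects-Img e Xe≡x Ye≡y I b (h , h∈I , yh≡Yb) =
    h , h∈I , trans (sym (Xe≡x h)) (proj₂ (proj₁ (ok (e h) b)) (trans (Ye≡y h) yh≡Yb))

record Interval : Set where
  constructor interval
  field
    lo width : ℕ

  mid : ℕ
  mid = lo + ⌊ width /2⌋

  hi : ℕ
  hi = lo + width
open Interval

mid+⌈width/2⌉≡hi : ∀ J → mid J + ⌈ width J /2⌉ ≡ hi J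
mid+⌈width/2⌉≡hi (interval l d) = trans (+-assoc l _ _) (cong (l +_) (⌊n/2⌋+⌈n/2⌉≡n d))

module Bisection {A : Set} {Q : A → Set} (Q? : Decidable Q) where

  halve : Interval → A → Interval
  halve J a = if does (Q? a) then interval (mid J) ⌈ width J /2⌉ else interval (lo J) ⌊ width J /2⌋

  bisect : Interval → (t : ℕ) → (Fin t → A) → Interval
  bisect J zero    _ = J
  bisect J (suc t) f = bisect (halve J (f zero)) t (f ∘ suc)

  bisect-snoc : ∀ J t (ρ : ℕ → A) → bisect J (suc t) (ρ ∘ toℕ) ≡ halve (bisect J t (ρ ∘ toℕ)) (ρ t)
  bisect-snoc J zero    ρ = refl
  bisect-snoc J (suc t) ρ = bisect-snoc (halve J (ρ 0)) t (ρ ∘ suc)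

  width-halve : ∀ J a → width (halve J a) ≤ ⌈ width J /2⌉
  width-halve J a with does (Q? a)
  ... | true  = ≤-refl
  ... | false = ⌊n/2⌋≤⌈n/2⌉ (width J)

  ⌈log₂width⌉-bisect : ∀ J t f → ⌈log₂ width (bisect J t f) ⌉ ≤ ⌈log₂ width J ⌉ ∸ t
  ⌈log₂width⌉-bisect J zero    f = ≤-refl
  ⌈log₂width⌉-bisect J (suc t) f = begin
    ⌈log₂ width (bisect (halve J (f zero)) t (f ∘ suc)) ⌉ ≤⟨ ⌈log₂width⌉-bisect _ t _ ⟩
    ⌈log₂ width (halve J (f zero)) ⌉ ∸ t                  ≤⟨ ∸-monoˡ-≤ t (⌈log₂⌉-mono-≤ (width-halve J _)) ⟩
    ⌈log₂ ⌈ width J /2⌉ ⌉ ∸ t                             ≡⟨ cong (_∸ t) (⌈log₂⌈n/2⌉⌉≡⌈log₂n⌉∸1 (width J)) ⟩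
    ⌈log₂ width J ⌉ ∸ 1 ∸ t                               ≡⟨ ∸-+-assoc ⌈log₂ width J ⌉ 1 t ⟩
    ⌈log₂ width J ⌉ ∸ suc t                               ∎
    where open ≤-Reasoning

  width-bisect≤1 : ∀ J t f → ⌈log₂ width J ⌉ ≤ t → width (bisect J t f) ≤ 1
  width-bisect≤1 J t f log≤t = ⌈log₂n⌉≡0⇒n≤1 (n≤0⇒n≡0
    (≤-trans (⌈log₂width⌉-bisect J t f) (≤-reflexive (m≤n⇒m∸n≡0 log≤t))))

  module Run (J₀ : Interval) (ρ : ℕ → A) where

    state : ℕ → Interval
    state t = bisect J₀ t (ρ ∘ toℕ)

    Queried : ℕ → (A → Set) → ℕ → Set
    Queried t R k = ∃ λ r → r < t × mid (state r) ≡ k × R (ρ r)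

    Queried-suc : ∀ {t R k} → Queried t R k → Queried (suc t) R k
    Queried-suc (r , r<t , mid≡k , Rρr) = r , m≤n⇒m≤1+n r<t , mid≡k , Rρr

    Labelled : ℕ → Interval → Set
    Labelled t J = (lo J ≡ lo J₀ ⊎ Queried t Q (lo J))
                 × (hi J ≡ hi J₀ ⊎ Queried t (¬_ ∘ Q) (hi J))

    halve-labelled : ∀ t → Labelled t (state t) → Labelled (suc t) (halve (state t) (ρ t))
    halve-labelled t (lo-label , hi-label) with Q? (ρ t)
    ... | yes q  = inj₂ (t , ≤-refl , refl , q)
                 , subst (λ k → k ≡ hi J₀ ⊎ Queried (suc t) (¬_ ∘ Q) k)
                         (sym (mid+⌈width/2⌉≡hi (state t)))
                         (Sum.map₂ (Queried-suc {t} {¬_ ∘ Q}) hi-label)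
    ... | no  ¬q = Sum.map₂ (Queried-suc {t} {Q}) lo-label , inj₂ (t , ≤-refl , refl , ¬q)

    state-labelled : ∀ t → Labelled t (state t)
    state-labelled zero    = inj₁ refl , inj₁ refl
    state-labelled (suc t) =
      subst (Labelled (suc t)) (sym (bisect-snoc J₀ t ρ)) (halve-labelled t (state-labelled t))

module SpoilerWins
  (G G' : ColoredGraph) (s : ℕ) (x : Fin s → V G) (y : Fin s → V G') (i j : Fin s) (I : Subset s)
  {F : Subset (size G)}
  (F-connected : ∀ u v → u ∈ F → v ∈ F → ConnIn G (λ w → ¬ Img x I w) u v)
  (F-closed : AdjClosed G (λ w → ¬ Img x I w) F)
  (xi∈F : x i ∈ F) (xj∈F : x j ∈ F)
  {F₁ : Subset (size G')} (F₁-closed : AdjClosed G' (λ w → ¬ Img y I w) F₁)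
  (yi∈F₁ : y i ∈ F₁) (yj∉F₁ : y j ∉ F₁)
  where

  path : Path (x i) (x j)
  path = toPath (F-connected (x i) (x j) xi∈F xj∈F)

  walk : ConnIn G (λ w → ¬ Img x I w) (x i) (x j)
  walk = proj₁ path

  p : ℕ → V G
  p = vertexAt walk

  K : ℕ
  K = ⌈log₂ ∣ F ∣ ⌉

  open Bisection (_∈? F₁)

  J₀ : Interval
  J₀ = interval 0 (len walk)

  ⌈log₂width⌉≤K : ⌈log₂ width J₀ ⌉ ≤ K
  ⌈log₂width⌉≤K = ⌈log₂⌉-mono-≤ (<⇒≤ (len<∣F∣ F-closed path xi∈F))

  strategy : SpoilerStrategyInG G G'
  strategy t f = p (mid (bisect J₀ t f))

  module Against (ρ : ℕ → V G') where
    open Run J₀ ρ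

    X : Fin (s + K) → V G
    X = extend s x (spoilerMoves {G} {G'} strategy ρ)

    Y : Fin (s + K) → V G'
    Y = extend s y ρ

    Pebbled : (V G' → Set) → V G → Set
    Pebbled R u = ∃ λ a → X a ≡ u × R (Y a)

    queried-pebbled : ∀ {R k} → Queried K R k → Pebbled R (p k)
    queried-pebbled {R} (r , r<K , mid≡k , Rρr) =
      s ↑ʳ fromℕ< r<K ,
      trans (extend-↑ʳ s K x _ _) (trans (cong (p ∘ mid ∘ state) (toℕ-fromℕ< r<K)) (cong p mid≡k)) ,
      subst R (sym (trans (extend-↑ʳ s K y ρ _) (cong ρ (toℕ-fromℕ< r<K)))) Rρr

    endpoint-pebbled : ∀ R {k k₀} h → p k₀ ≡ x h → R (y h) →
                       k ≡ k₀ ⊎ Queried K R k → Pebbled R (p k)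
    endpoint-pebbled R h pk₀≡xh Ryh (inj₁ refl) =
      h ↑ˡ K , trans (extend-↑ˡ s K x _ h) (sym pk₀≡xh) , subst R (sym (extend-↑ˡ s K y ρ h)) Ryh
    endpoint-pebbled R h _ _ (inj₂ queried) = queried-pebbled {R} queried

    final : Interval
    final = state K

    lo-pebbled : Pebbled (_∈ F₁) (p (lo final))
    lo-pebbled = endpoint-pebbled (_∈ F₁) i (vertexAt-zero walk) yi∈F₁ (proj₁ (state-labelled K))

    hi-pebbled : Pebbled (_∉ F₁) (p (hi final))
    hi-pebbled = endpoint-pebbled (_∉ F₁) j (vertexAt-len walk) yj∉F₁ (proj₂ (state-labelled K))

    spoiler-wins : ¬ DupOK G G' (s + K) X Y
    spoiler-wins ok = separated lo-pebbled hi-pebbled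
      where
      separated : Pebbled (_∈ F₁) (p (lo final)) → ¬ Pebbled (_∉ F₁) (p (hi final))
      separated (a , Xa≡plo , Ya∈F₁) (b , Xb≡phi , Yb∉F₁) =
        Yb∉F₁ (AdjClosed-AdjOrEq {G'} F₁-closed (DupOK-preserves-AdjOrEq {G} {G'} ok a b Xa~Xb)
                                 Ya∈F₁ Yb∉Img)
        where
        Xa~Xb : AdjOrEq G (X a) (X b)
        Xa~Xb = subst₂ (AdjOrEq G) (sym Xa≡plo) (sym Xb≡phi)
          (vertexAt-+≤1 walk (lo final) (width-bisect≤1 J₀ K _ ⌈log₂width⌉≤K))

        Yb∉Img : ¬ Img y I (Y b)
        Yb∉Img Yb∈Img = vertexAt-inside walk (hi final) (subst (Img x I) Xb≡phi
          (DupOK-reflects-Img {G} {G'} ok (_↑ˡ K) (extend-↑ˡ s K x _) (extend-↑ˡ s K y ρ) I b Yb∈Img))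

lemma3p1 : (G G' : ColoredGraph) (s : ℕ) (x : Fin s → V G) (y : Fin s → V G')
    (i j : Fin s) (I : Subset s) (F : Subset (size G)) →
    IsFlap G (Img x I) F → x i ∈ F → x j ∈ F →
    (∃ λ F₁ → ∃ λ F₂ → IsFlap G' (Img y I) F₁ × IsFlap G' (Img y I) F₂
       × y i ∈ F₁ × y j ∈ F₂ × y j ∉ F₁) →
    Σ (SpoilerStrategyInG G G') λ σ → ∀ (ρ : ℕ → V G') →
      ∃ λ t → t ≤ ⌈log₂ ∣ F ∣ ⌉ ×
        ¬ DupOK G G' (s + t) (extend s x (spoilerMoves {G} {G'} σ ρ)) (extend s y ρ)
lemma3p1 G G' s x y i j I F (_ , _ , F-connected , F-closed) xi∈F xj∈F
         (F₁ , _ , (_ , _ , _ , F₁-closed) , _ , yi∈F₁ , _ , yj∉F₁) =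
  strategy , λ ρ → K , ≤-refl , Against.spoiler-wins ρ
  where
  open SpoilerWins G G' s x y i j I F-connected F-closed xi∈F xj∈F F₁-closed yi∈F₁ yj∉F₁
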